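{- Let \(\mathbb D\) be the type of dyadics with the relation \(\prec\) described in the context. The ideal completion \(\mathrm{Idl}_{\mathcal U_0}(\mathbb D,\prec)\) (a \(\mathcal U_0\)-dcpo with carrier in \(\mathcal U_1\) and order valued in \(\mathcal U_0\)) is continuous with small basis \({\downarrow}(-) : \mathbb D\to\mathrm{Idl}_{\mathcal U_0}(\mathbb D,\prec)\), \(b\mapsto\{a\mid a\prec b\}\). Moreover, it is not algebraic: none of its elements are compact.
   Context: We work constructively and predicatively in univalent foundations with universes \(\mathcal U_0,\mathcal U_1,\dots\) and propositional truncation. The dyadics \(\mathbb D:\mathcal U_0\) form the inductive type with constructors \(\mathrm{middle}:\mathbb D\), \(\mathrm{left},\mathrm{right}:\mathbb D\to\mathbb D\). The relation \(\prec:\mathbb D\to\mathbb D\to\mathcal U_0\) is defined recursively (\(\mathbf 0\) empty, \(\mathbf 1\) unit): \(\mathrm{middle}\prec\mathrm{middle} = \mathbf 0\); \(\mathrm{middle}\prec\mathrm{left}(y)=\mathbf 0\); \(\mathrm{middle}\prec\mathrm{right}(y)=\mathbf 1\); \(\mathrm{left}(x)\prec\mathrm{middle}=\mathbf 1\); \(\mathrm{left}(x)\prec\mathrm{left}(y) = (x\prec y)\); \(\mathrm{left}(x)\prec\mathrm{right}(y)=\mathbf 1\); \(\mathrm{right}(x)\prec\mathrm{middle}=\mathbf 0\); \(\mathrm{right}(x)\prec\mathrm{left}(y)=\mathbf 0\); \(\mathrm{right}(x)\prec\mathrm{right}(y)=(x\prec y)\). An ideal of \((\mathbb D,\prec)\)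 is a subset \(I:\mathbb D\to\Omega_{\mathcal U_0}\) that is a lower set (\(a\prec b\in I\Rightarrow a\in I\)) and directed (inhabited; any \(b_1,b_2\in I\) have (there exists) \(b\in I\) with \(b_1,b_2\prec b\)); \(\mathrm{Idl}_{\mathcal U_0}(\mathbb D,\prec)\) is the poset of ideals under inclusion, in which directed unions of ideals indexed by types in \(\mathcal U_0\) are suprema. Directed family: inhabited index, any two indices have a common upper index. Way-below: \(x\ll y\) iff for every directed \(\alpha:I\to D\), \(I:\mathcal U_0\), with \(y\sqsubseteq\bigsqcup\alpha\) there exists \(i\) with \(x\sqsubseteq\alpha_i\); compact: \(x\ll x\). Small basis: \(\beta:B\to D\), \(B:\mathcal U_0\), with each family \(\Sigma_{b:B}(\beta(b)\ll x)\to D\) (via \(\beta\)) directed with supremum \(x\) and each \(\beta(b)\ll x\) \(\mathcal U_0\)-small. Continuous: there exists (truncated) continuity data, i.e. an assignment to each \(x\) of a type \(I_x:\mathcal U_0\) and directed \(\alpha_x:I_x\to D\) with supremum \(x\) and each \(\alpha_x(i)\ll x\). Algebraic: there exists an assignment to each \(x\) of a directed family, indexed by a type in \(\mathcal U_0\), of compact elements with supremum \(x\). -}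

module Defs where

open import Level using (Level; _⊔_; Setω; 0ℓ) renaming (zero to lzero; suc to lsuc)
open import Data.Empty using (⊥; ⊥-elim)
open import Data.Unit using (⊤; tt)
open import Data.Product using (Σ; _×_; _,_; proj₁; proj₂)
open import Data.Sum using (_⊎_; inj₁; inj₂)
open import Relation.Binary.PropositionalEquality using (_≡_; refl; cong; subst)
open import Function.Bundles using (_↔_)
open import Axiom.Extensionality.Propositional using (Extensionality)

isProp : ∀ {a} → Set a → Set a
isProp A = (x y : A) → x ≡ y

-- Propositional truncation (as a structure; Agda --safe has no HITs)
record PropTrunc : Setω where
  field
    ∥_∥      : ∀ {a} → Set a → Set a
    ∥∥-isProp : ∀ {a} {A : Set a} → isProp ∥ A ∥
    ∣_∣      : ∀ {a} {A : Set a} → A → ∥ A ∥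
    ∥∥-rec   : ∀ {a b} {A : Set a} {P : Set b} → isProp P → (A → P) → ∥ A ∥ → P

FunExt : Setω
FunExt = ∀ {a b} → Extensionality a b

-- Ω_{U₀}: propositions in U₀ = Set
Ω₀ : Set₁
Ω₀ = Σ Set isProp

data 𝔻 : Set where
  middle : 𝔻
  left   : 𝔻 → 𝔻
  right  : 𝔻 → 𝔻

infix 4 _≺_
_≺_ : 𝔻 → 𝔻 → Set
middle  ≺ middle  = ⊥
middle  ≺ left y  = ⊥
middle  ≺ right y = ⊤
left x  ≺ middle  = ⊤
left x  ≺ left y  = x ≺ y
left x  ≺ right y = ⊤
right x ≺ middle  = ⊥
right x ≺ left y  = ⊥
right x ≺ right y = x ≺ y

≺-isProp : ∀ x y → isProp (x ≺ y)
≺-isProp middle  (right y) tt tt = refl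
≺-isProp (left x)  middle  tt tt = refl
≺-isProp (left x)  (left y)  p q = ≺-isProp x y p q
≺-isProp (left x)  (right y) tt tt = refl
≺-isProp (right x) (right y) p q = ≺-isProp x y p q

≺-trans : ∀ x y z → x ≺ y → y ≺ z → x ≺ z
≺-trans middle    (right y) (right z) p q = tt
≺-trans (left x)  middle    (right z) p q = tt
≺-trans (left x)  (left y)  middle    p q = tt
≺-trans (left x)  (left y)  (left z)  p q = ≺-trans x y z p q
≺-trans (left x)  (left y)  (right z) p q = tt
≺-trans (left x)  (right y) (right z) p q = tt
≺-trans (right x) (right y) (right z) p q = ≺-trans x y z p q

below : ∀ y → Σ 𝔻 (λ x → x ≺ y)
below middle    = left middle , tt
below (left y)  = left (proj₁ (below y)) , proj₂ (below y)
below (right y) = middle , tt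

above : ∀ x → Σ 𝔻 (λ y → x ≺ y)
above middle    = right middle , tt
above (left x)  = middle , tt
above (right x) = right (proj₁ (above x)) , proj₂ (above x)

interpolate : ∀ x y → x ≺ y → Σ 𝔻 (λ z → (x ≺ z) × (z ≺ y))
interpolate middle    (right y) p = right (proj₁ (below y)) , tt , proj₂ (below y)
interpolate (left x)  middle    p = left (proj₁ (above x)) , proj₂ (above x) , tt
interpolate (left x)  (left y)  p with interpolate x y p
... | z , q , r = left z , q , r
interpolate (left x)  (right y) p = middle , tt , tt
interpolate (right x) (right y) p with interpolate x y p
... | z , q , r = right z , q , r

trichotomy : ∀ x y → (x ≺ y) ⊎ ((x ≡ y) ⊎ (y ≺ x))
trichotomy middle    middle    = inj₂ (inj₁ refl)
trichotomy middle    (left y)  = inj₂ (inj₂ tt)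
trichotomy middle    (right y) = inj₁ tt
trichotomy (left x)  middle    = inj₁ tt
trichotomy (left x)  (left y)  with trichotomy x y
... | inj₁ p = inj₁ p
... | inj₂ (inj₁ e) = inj₂ (inj₁ (cong left e))
... | inj₂ (inj₂ p) = inj₂ (inj₂ p)
trichotomy (left x)  (right y) = inj₁ tt
trichotomy (right x) middle    = inj₂ (inj₂ tt)
trichotomy (right x) (left y)  = inj₂ (inj₂ tt)
trichotomy (right x) (right y) with trichotomy x y
... | inj₁ p = inj₁ p
... | inj₂ (inj₁ e) = inj₂ (inj₁ (cong right e))
... | inj₂ (inj₂ p) = inj₂ (inj₂ p)

↓-directed : ∀ b b₁ b₂ → b₁ ≺ b → b₂ ≺ b →
             Σ 𝔻 (λ c → (c ≺ b) × ((b₁ ≺ c) × (b₂ ≺ c)))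
↓-directed b b₁ b₂ p₁ p₂ with trichotomy b₁ b₂
... | inj₁ q with interpolate b₂ b p₂
...   | c , r , s = c , s , ≺-trans b₁ b₂ c q r , r
↓-directed b b₁ b₂ p₁ p₂ | inj₂ (inj₁ refl) with interpolate b₁ b p₁
...   | c , r , s = c , s , r , r
↓-directed b b₁ b₂ p₁ p₂ | inj₂ (inj₂ q) with interpolate b₁ b p₁
...   | c , r , s = c , s , r , ≺-trans b₂ b₁ c q r

module WithPT (pt : PropTrunc) where
  open PropTrunc pt

  ∃∥ : ∀ {a b} (A : Set a) → (A → Set b) → Set (a ⊔ b)
  ∃∥ A P = ∥ Σ A P ∥

  record Idl : Set₁ where
    field
      carrier   : 𝔻 → Ω₀
    _∈I : 𝔻 → Set
    a ∈I = proj₁ (carrier a)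
    field
      lower     : ∀ a b → a ≺ b → b ∈I → a ∈I
      inhabited : ∃∥ 𝔻 (λ b → b ∈I)
      directed  : ∀ b₁ b₂ → b₁ ∈I → b₂ ∈I →
                  ∃∥ 𝔻 (λ b → (b ∈I) × ((b₁ ≺ b) × (b₂ ≺ b)))

  infix 4 _∈_ _⊑_ _≪_
  _∈_ : 𝔻 → Idl → Set
  a ∈ I = proj₁ (Idl.carrier I a)

  _⊑_ : Idl → Idl → Set
  I ⊑ J = ∀ a → a ∈ I → a ∈ J

  -- directed families (index in any universe; way-below below only
  -- quantifies over families indexed by types in U₀)
  IsDirected : ∀ {ℓ} {X : Set ℓ} → (X → Idl) → Set ℓ
  IsDirected {X = X} α = ∥ X ∥ × (∀ i j → ∃∥ X (λ k → (α i ⊑ α k) × (α j ⊑ α k)))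

  IsSup : ∀ {ℓ} {X : Set ℓ} → (X → Idl) → Idl → Set (lsuc lzero ⊔ ℓ)
  IsSup {X = X} α s = (∀ i → α i ⊑ s) × (∀ u → (∀ i → α i ⊑ u) → s ⊑ u)

  _≪_ : Idl → Idl → Set₁
  x ≪ y = ∀ (X : Set) (α : X → Idl) → IsDirected α →
          ∀ (s : Idl) → IsSup α s → y ⊑ s → ∃∥ X (λ i → x ⊑ α i)

  IsCompact : Idl → Set₁
  IsCompact x = x ≪ x

  IsSmall : Set₁ → Set₁
  IsSmall P = Σ Set (λ X → X ↔ P)

  IsSmallBasis : {B : Set} → (B → Idl) → Set₁
  IsSmallBasis {B} β =
    ∀ (x : Idl) →
      (IsDirected {X = Σ B (λ b → β b ≪ x)} (λ p → β (proj₁ p))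
       × IsSup {X = Σ B (λ b → β b ≪ x)} (λ p → β (proj₁ p)) x)
      × (∀ b → IsSmall (β b ≪ x))

  IsContinuous : Set₁
  IsContinuous =
    ∥ ((x : Idl) → Σ Set (λ I → Σ (I → Idl) (λ α →
         (IsDirected α × IsSup α x) × (∀ i → α i ≪ x)))) ∥

  IsAlgebraic : Set₁
  IsAlgebraic =
    ∥ ((x : Idl) → Σ Set (λ I → Σ (I → Idl) (λ α →
         (IsDirected α × IsSup α x) × (∀ i → IsCompact (α i))))) ∥

  ↓ : 𝔻 → Idl
  ↓ b = record
    { carrier   = λ a → (a ≺ b) , ≺-isProp a b
    ; lower     = λ a c p q → ≺-trans a c b p q
    ; inhabited = ∣ below b ∣
    ; directed  = λ b₁ b₂ p₁ p₂ → ∣ ↓-directed b b₁ b₂ p₁ p₂ ∣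
    }

module Submission where

open import Defs
open import Data.Product using (Σ; _×_; _,_; proj₂)
open import Data.Sum using (_⊎_; inj₁; inj₂)
open import Data.Empty using (⊥)
open import Relation.Nullary using (¬_; contradiction)
open import Relation.Binary.PropositionalEquality using (_≡_; refl)
open import Function.Bundles using (mk↔ₛ′)

-- Every ideal x is the directed union of the ↓ c with c ∈ x (ideals are rounded),
-- and ↓ b ≪ x holds exactly when b ∈ x. Hence the ↓ b form a small basis. If x were
-- compact, x ⊑ ↓ c for some c ∈ x, giving c ≺ c; so no ideal is compact, and since
-- algebraic data would supply a compact element, the ideal completion is not algebraic.

≺-irrefl : ∀ x → ¬ x ≺ x
≺-irrefl middle    ()
≺-irrefl (left x)  p = ≺-irrefl x p
≺-irrefl (right x) p = ≺-irrefl x p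

module IdealCompletion (pt : PropTrunc) where
  open PropTrunc pt
  open WithPT pt

  ∥∥-map : ∀ {a b} {A : Set a} {B : Set b} → (A → B) → ∥ A ∥ → ∥ B ∥
  ∥∥-map f = ∥∥-rec ∥∥-isProp (λ a → ∣ f a ∣)

  ⊥-isProp : isProp ⊥
  ⊥-isProp ()

  ∈-isProp : ∀ {a} (x : Idl) → isProp (a ∈ x)
  ∈-isProp {a} x = proj₂ (Idl.carrier x a)

  ⊑-refl : ∀ x → x ⊑ x
  ⊑-refl x a h = h

  ↓-mono : ∀ {b c} → b ≺ c → ↓ b ⊑ ↓ c
  ↓-mono {b} {c} p a q = ≺-trans a b c q p

  ↓-⊑⇒≼ : ∀ b c → ↓ b ⊑ ↓ c → (b ≺ c) ⊎ (b ≡ c)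
  ↓-⊑⇒≼ b c le with trichotomy b c
  ... | inj₁ p         = inj₁ p
  ... | inj₂ (inj₁ e)  = inj₂ e
  ... | inj₂ (inj₂ c≺b) with interpolate c b c≺b
  ...   | z , c≺z , z≺b = contradiction (≺-trans c z c c≺z (le z z≺b)) (≺-irrefl c)

  ∈-↓-reflects : ∀ {b c} (x : Idl) → c ∈ x → ↓ b ⊑ ↓ c → b ∈ x
  ∈-↓-reflects {b} {c} x c∈x le with ↓-⊑⇒≼ b c le
  ... | inj₁ b≺c  = Idl.lower x b c b≺c c∈x
  ... | inj₂ refl = c∈x

  ∈-rounded : ∀ {a} (x : Idl) → a ∈ x → ∃∥ 𝔻 (λ c → (c ∈ x) × (a ≺ c))
  ∈-rounded {a} x a∈x =
    ∥∥-map (λ { (c , c∈x , a≺c , _) → c , c∈x , a≺c }) (Idl.directed x a a a∈x a∈x)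

  -- The basis and the continuity data index the family ↓ c by two equivalent
  -- descriptions P of the points c of x.
  module ↓-Family {ℓ} (x : Idl) {P : 𝔻 → Set ℓ}
                  (to : ∀ {c} → c ∈ x → P c) (from : ∀ {c} → P c → c ∈ x) where

    ↓-family : Σ 𝔻 P → Idl
    ↓-family (c , _) = ↓ c

    isDirected : IsDirected ↓-family
    isDirected =
        ∥∥-map (λ { (c , c∈x) → c , to c∈x }) (Idl.inhabited x)
      , λ { (c₁ , p₁) (c₂ , p₂) →
            ∥∥-map (λ { (c , c∈x , c₁≺c , c₂≺c) → (c , to c∈x) , ↓-mono c₁≺c , ↓-mono c₂≺c })
                   (Idl.directed x c₁ c₂ (from p₁) (from p₂)) }

    isSup : IsSup ↓-family x
    isSup = (λ { (c , p) a a≺c → Idl.lower x a c a≺c (from p) })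
          , λ u ub a a∈x → ∥∥-rec (∈-isProp u)
              (λ { (c , c∈x , a≺c) → ub (c , to c∈x) a a≺c }) (∈-rounded x a∈x)

  ⋃ : {X : Set} (α : X → Idl) → IsDirected α → Idl
  ⋃ {X} α (inhabited , directed) = record
    { carrier   = λ a → ∃∥ X (λ i → a ∈ α i) , ∥∥-isProp
    ; lower     = λ a b a≺b → ∥∥-map (λ { (i , b∈αi) → i , Idl.lower (α i) a b a≺b b∈αi })
    ; inhabited = ∥∥-rec ∥∥-isProp
        (λ i → ∥∥-map (λ { (b , b∈αi) → b , ∣ i , b∈αi ∣ }) (Idl.inhabited (α i))) inhabited
    ; directed  = λ b₁ b₂ b₁∈⋃ b₂∈⋃ →
        ∥∥-rec ∥∥-isProp (λ { (i , b₁∈αi) →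
          ∥∥-rec ∥∥-isProp (λ { (j , b₂∈αj) →
            ∥∥-rec ∥∥-isProp (λ { (k , αi⊑αk , αj⊑αk) →
              ∥∥-map (λ { (c , c∈αk , b₁≺c , b₂≺c) → c , ∣ k , c∈αk ∣ , b₁≺c , b₂≺c })
                     (Idl.directed (α k) b₁ b₂ (αi⊑αk b₁ b₁∈αi) (αj⊑αk b₂ b₂∈αj)) })
              (directed i j) }) b₂∈⋃ }) b₁∈⋃
    }

  -- Directed suprema are unions: s ⊑ ⋃ α, so b lies in some α i.
  ∈⇒↓≪ : ∀ {b} (x : Idl) → b ∈ x → ↓ b ≪ x
  ∈⇒↓≪ {b} x b∈x X α α-directed s s-sup x⊑s =
    ∥∥-map (λ { (i , b∈αi) → i , (λ a a≺b → Idl.lower (α i) a b a≺b b∈αi) })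
           (proj₂ s-sup (⋃ α α-directed) (λ i a a∈αi → ∣ i , a∈αi ∣) b (x⊑s b b∈x))

  module Canonical (x : Idl) = ↓-Family x {λ c → c ∈ x} (λ h → h) (λ h → h)

  ≪⇒⊑↓ : ∀ y x → y ≪ x → ∃∥ (Σ 𝔻 (_∈ x)) (λ { (c , _) → y ⊑ ↓ c })
  ≪⇒⊑↓ y x y≪x = y≪x _ ↓-family isDirected x isSup (⊑-refl x)
    where open Canonical x

  ↓≪⇒∈ : ∀ {b} (x : Idl) → ↓ b ≪ x → b ∈ x
  ↓≪⇒∈ {b} x ↓b≪x =
    ∥∥-rec (∈-isProp x) (λ { ((c , c∈x) , le) → ∈-↓-reflects x c∈x le }) (≪⇒⊑↓ (↓ b) x ↓b≪x)

  ≪-isProp : FunExt → ∀ y x → isProp (y ≪ x)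
  ≪-isProp fe y x f g = fe λ _ → fe λ _ → fe λ _ → fe λ _ → fe λ _ → fe λ _ → ∥∥-isProp _ _

  ↓-isSmallBasis : FunExt → IsSmallBasis ↓
  ↓-isSmallBasis fe x =
      (isDirected , isSup)
    , λ b → (b ∈ x) , mk↔ₛ′ (∈⇒↓≪ x) (↓≪⇒∈ x) (λ _ → ≪-isProp fe (↓ b) x _ _) (λ _ → ∈-isProp x _ _)
    where open ↓-Family x (∈⇒↓≪ x) (↓≪⇒∈ x)

  isContinuous : IsContinuous
  isContinuous = ∣ (λ x → let open Canonical x in
                     Σ 𝔻 (_∈ x) , ↓-family , (isDirected , isSup) , λ { (c , c∈x) → ∈⇒↓≪ x c∈x }) ∣

  ¬isCompact : ∀ (x : Idl) → ¬ IsCompact x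
  ¬isCompact x x≪x =
    ∥∥-rec ⊥-isProp (λ { ((c , c∈x) , x⊑↓c) → ≺-irrefl c (x⊑↓c c c∈x) }) (≪⇒⊑↓ x x x≪x)

  ¬isAlgebraic : ¬ IsAlgebraic
  ¬isAlgebraic = ∥∥-rec ⊥-isProp λ approx →
    let (_ , α , ((inhabited , _) , _) , compact) = approx (↓ middle)
    in ∥∥-rec ⊥-isProp (λ i → ¬isCompact (α i) (compact i)) inhabited

proposition6p22 : (pt : PropTrunc) → FunExt →
    let open WithPT pt in
    (IsSmallBasis ↓ × IsContinuous) × (¬ IsAlgebraic × (∀ (x : Idl) → ¬ IsCompact x))
proposition6p22 pt fe = (↓-isSmallBasis fe , isContinuous) , (¬isAlgebraic , ¬isCompact)
  where open IdealCompletion pt
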